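{- Let $\varphi$ be a formula of the bounded frame language, $h>0$ the frame step and $n$ the number of frames. Then $\varphi$ has a streaming monitor with delay at most $L(\varphi)$ seconds: for every frame $i$ and any two environments $E,E'$ on the same $n$-frame grid that agree on every atom at all frames $j$ with $0\le j\le \min(n-1,\,i+L(\varphi)/h)$, one has $[\![\varphi]\!]_E(i)=[\![\varphi]\!]_{E'}(i)$; hence the verdict for frame $i$ can be emitted once the frames up to time $ih+L(\varphi)$ have arrived, using a finite buffer.
   Context: Frames are indexed $0,\dots,n-1$. An environment $E$ assigns to each atom an array in $\{0,1\}^n$. Formulas: $\varphi ::= a \mid \neg\varphi \mid \varphi\wedge\psi \mid \varphi\vee\psi \mid \varphi\Rightarrow\psi \mid \varphi\,U_\epsilon\,\psi \mid N_\epsilon\varphi \mid F_\epsilon\varphi \mid G_\epsilon\varphi$ ($\epsilon\ge0$). Valuation $[\![\varphi]\!]_E\in\{0,1\}^n$: atoms read from $E$; Boolean connectives pointwise ($\Rightarrow$ material implication). With $r_\epsilon=\lceil\epsilon/h\rceil$: $N_\epsilon\varphi$ true at $i$ iff $[\![\varphi]\!]_E(j)=1$ for some $0\le j<n$ with $|i-j|\le r_\epsilon$; $F_\epsilon\varphi$ true at $i$ iff $[\![\varphi]\!]_E(j)=1$ for some $i\le j\le\min(n-1,i+r_\epsilon)$; $G_\epsilon\varphi$ true at $i$ iff $[\![\varphi]\!]_E(j)=1$ for all $i\le j\le\min(n-1,i+r_\epsilon)$; $\varphi\,U_\epsilon\,\psi$ true at $i$ iff there is $j<n$ with $0\le j-i\le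 r_\epsilon$, $[\![\psi]\!]_E(j)=1$, and $[\![\varphi]\!]_E(m)=1$ for every frame $m$ from $i$ up to $j$. The lookahead $L(\varphi)$ (in seconds) is defined recursively: $L(a)=0$; $L(\neg\varphi)=L(\varphi)$; $L(\varphi\circ\psi)=\max(L(\varphi),L(\psi))$ for $\circ\in\{\wedge,\vee,\Rightarrow\}$; $L(N_\epsilon\varphi)=L(F_\epsilon\varphi)=L(G_\epsilon\varphi)=L(\varphi)+r_\epsilon h$; $L(\varphi\,U_\epsilon\,\psi)=\max(L(\varphi),L(\psi))+r_\epsilon h$.
   Formalization: The frame step h and the time bounds ε of the temporal operators take values in the rationals. -}

module Defs where

open import Data.Bool using (Bool; true; false; _∧_; _∨_; not)
open import Data.Nat as ℕ using (ℕ; zero; suc; _∸_)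
open import Data.Fin using (Fin; toℕ)
import Data.Fin as Fin
import Data.Integer as ℤ
open import Data.Rational as ℚ using (ℚ; 0ℚ; _÷_; _*_; _>_; _≤_; ceiling; >-nonZero)

data Formula (A : Set) : Set where
  atom : A → Formula A
  ¬′_  : Formula A → Formula A
  _∧′_ _∨′_ _⇒′_ : Formula A → Formula A → Formula A
  U′   : (ε : ℚ) → 0ℚ ≤ ε → Formula A → Formula A → Formula A
  N′ F′ G′ : (ε : ℚ) → 0ℚ ≤ ε → Formula A → Formula A

Env : Set → ℕ → Set
Env A n = A → Fin n → Bool

-- r_ε = ⌈ ε / h ⌉  (a natural number since ε ≥ 0, h > 0)
r : (h : ℚ) → h > 0ℚ → ℚ → ℕ
r h hp ε = ℤ.∣ ceiling (_÷_ ε h {{>-nonZero hp}}) ∣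

anyF : ∀ {n} → (Fin n → Bool) → Bool
anyF {zero}  P = false
anyF {suc n} P = P Fin.zero ∨ anyF (λ j → P (Fin.suc j))

allF : ∀ {n} → (Fin n → Bool) → Bool
allF {zero}  P = true
allF {suc n} P = P Fin.zero ∧ allF (λ j → P (Fin.suc j))

dist : ℕ → ℕ → ℕ
dist i j = (i ∸ j) ℕ.+ (j ∸ i)

inWin : ℕ → ℕ → ℕ → Bool
inWin i k j = (i ℕ.≤ᵇ j) ∧ (j ℕ.≤ᵇ i ℕ.+ k)

⟦_⟧ : ∀ {A n} → Formula A → (h : ℚ) → h > 0ℚ → Env A n → Fin n → Bool
⟦ atom a ⟧ h hp E i = E a i
⟦ ¬′ φ ⟧ h hp E i = not (⟦ φ ⟧ h hp E i)
⟦ φ ∧′ ψ ⟧ h hp E i = ⟦ φ ⟧ h hp E i ∧ ⟦ ψ ⟧ h hp E i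
⟦ φ ∨′ ψ ⟧ h hp E i = ⟦ φ ⟧ h hp E i ∨ ⟦ ψ ⟧ h hp E i
⟦ φ ⇒′ ψ ⟧ h hp E i = not (⟦ φ ⟧ h hp E i) ∨ ⟦ ψ ⟧ h hp E i
⟦ N′ ε _ φ ⟧ h hp E i =
  anyF (λ j → (dist (toℕ i) (toℕ j) ℕ.≤ᵇ r h hp ε) ∧ ⟦ φ ⟧ h hp E j)
⟦ F′ ε _ φ ⟧ h hp E i =
  anyF (λ j → inWin (toℕ i) (r h hp ε) (toℕ j) ∧ ⟦ φ ⟧ h hp E j)
⟦ G′ ε _ φ ⟧ h hp E i =
  allF (λ j → not (inWin (toℕ i) (r h hp ε) (toℕ j)) ∨ ⟦ φ ⟧ h hp E j)
⟦ U′ ε _ φ ψ ⟧ h hp E i =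
  anyF (λ j → inWin (toℕ i) (r h hp ε) (toℕ j) ∧ ⟦ ψ ⟧ h hp E j
              ∧ allF (λ m → not (inWin (toℕ i) (toℕ j ∸ toℕ i) (toℕ m)) ∨ ⟦ φ ⟧ h hp E m))

ℕ→ℚ : ℕ → ℚ
ℕ→ℚ k = ℤ.+ k ℚ./ 1

L : ∀ {A} → (h : ℚ) → h > 0ℚ → Formula A → ℚ
L h hp (atom a) = 0ℚ
L h hp (¬′ φ) = L h hp φ
L h hp (φ ∧′ ψ) = L h hp φ ℚ.⊔ L h hp ψ
L h hp (φ ∨′ ψ) = L h hp φ ℚ.⊔ L h hp ψ
L h hp (φ ⇒′ ψ) = L h hp φ ℚ.⊔ L h hp ψ
L h hp (N′ ε _ φ) = L h hp φ ℚ.+ ℕ→ℚ (r h hp ε) * h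
L h hp (F′ ε _ φ) = L h hp φ ℚ.+ ℕ→ℚ (r h hp ε) * h
L h hp (G′ ε _ φ) = L h hp φ ℚ.+ ℕ→ℚ (r h hp ε) * h
L h hp (U′ ε _ φ ψ) = (L h hp φ ℚ.⊔ L h hp ψ) ℚ.+ ℕ→ℚ (r h hp ε) * h

-- Each temporal operator with bound ε reads its operands only at frames at most r_ε
-- beyond the current one (N also looks backwards, but earlier frames are covered by the
-- hypothesis anyway). So, by induction on φ, ⟦ φ ⟧ at frame i depends only on the atoms
-- at frames up to i + K φ, where K φ is the lookahead counted in frames. Every summand
-- of L φ is a multiple r_ε h of the frame step, hence L φ = K φ · h and L φ / h = K φ.
module Submission where

open import Defs
open import Data.Bool using (Bool)
open import Data.Nat using (ℕ)
open import Data.Fin using (Fin; toℕ)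
open import Relation.Binary.PropositionalEquality using (_≡_)

-- ℕ's _≤_ and _+_ live in this module so that they do not clash with ℚ's in the statement.
module FrameLocality where

  open import Data.Bool using (T; _∧_; _∨_; not)
  open import Data.Bool.Properties using (T-∧)
  open import Data.Nat as ℕ using (zero; suc; _≤_; _∸_; _⊔_; _≤ᵇ_)
  open import Data.Nat.Properties
    using (≤-refl; ≤-trans; +-mono-≤; +-monoʳ-≤; +-assoc; +-comm; m≤m+n; m≤n+m;
           m≤m⊔n; m≤n⊔m; m≤n+m∸n; m≤n+o⇒m∸n≤o; ≤ᵇ⇒≤; module ≤-Reasoning)
  import Data.Fin as Fin
  open import Data.Rational using (ℚ; 0ℚ; _>_)
  open import Data.Product using (proj₂)
  open import Function using (_∘_)
  open import Function.Bundles using (Equivalence)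
  open import Relation.Binary.PropositionalEquality using (_≡_; refl; cong; cong₂)

  lookaheadFrames : ∀ {A} (h : ℚ) → h > 0ℚ → Formula A → ℕ
  lookaheadFrames h hp (atom a)     = 0
  lookaheadFrames h hp (¬′ φ)       = lookaheadFrames h hp φ
  lookaheadFrames h hp (φ ∧′ ψ)     = lookaheadFrames h hp φ ⊔ lookaheadFrames h hp ψ
  lookaheadFrames h hp (φ ∨′ ψ)     = lookaheadFrames h hp φ ⊔ lookaheadFrames h hp ψ
  lookaheadFrames h hp (φ ⇒′ ψ)     = lookaheadFrames h hp φ ⊔ lookaheadFrames h hp ψ
  lookaheadFrames h hp (N′ ε _ φ)   = lookaheadFrames h hp φ ℕ.+ r h hp ε
  lookaheadFrames h hp (F′ ε _ φ)   = lookaheadFrames h hp φ ℕ.+ r h hp ε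
  lookaheadFrames h hp (G′ ε _ φ)   = lookaheadFrames h hp φ ℕ.+ r h hp ε
  lookaheadFrames h hp (U′ ε _ φ ψ) = (lookaheadFrames h hp φ ⊔ lookaheadFrames h hp ψ) ℕ.+ r h hp ε

  AgreeUpTo : ∀ {A n} → Env A n → Env A n → ℕ → Set
  AgreeUpTo {A} {n} E E′ m = (a : A) (j : Fin n) → toℕ j ≤ m → E a j ≡ E′ a j

  anyF-cong : ∀ {n} {P Q : Fin n → Bool} → (∀ j → P j ≡ Q j) → anyF P ≡ anyF Q
  anyF-cong {zero}  P≡Q = refl
  anyF-cong {suc n} P≡Q = cong₂ _∨_ (P≡Q Fin.zero) (anyF-cong (P≡Q ∘ Fin.suc))

  allF-cong : ∀ {n} {P Q : Fin n → Bool} → (∀ j → P j ≡ Q j) → allF P ≡ allF Q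
  allF-cong {zero}  P≡Q = refl
  allF-cong {suc n} P≡Q = cong₂ _∧_ (P≡Q Fin.zero) (allF-cong (P≡Q ∘ Fin.suc))

  guarded-∧-cong : ∀ b {x y : Bool} → (T b → x ≡ y) → b ∧ x ≡ b ∧ y
  guarded-∧-cong Bool.true  x≡y = x≡y _
  guarded-∧-cong Bool.false x≡y = refl

  guarded-⇒-cong : ∀ b {x y : Bool} → (T b → x ≡ y) → not b ∨ x ≡ not b ∨ y
  guarded-⇒-cong Bool.true  x≡y = x≡y _
  guarded-⇒-cong Bool.false x≡y = refl

  inWin⇒≤ : ∀ i k j → T (inWin i k j) → j ≤ i ℕ.+ k
  inWin⇒≤ i k j j∈ = ≤ᵇ⇒≤ j (i ℕ.+ k) (proj₂ (Equivalence.to (T-∧ {i ≤ᵇ j}) j∈))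

  dist≤⇒≤ : ∀ i j k → T (dist i j ≤ᵇ k) → j ≤ i ℕ.+ k
  dist≤⇒≤ i j k d≤k = ≤-trans (m≤n+m∸n j i)
    (+-monoʳ-≤ i (≤-trans (m≤n+m (j ∸ i) (i ∸ j)) (≤ᵇ⇒≤ (dist i j) k d≤k)))

  prefix⇒≤ : ∀ i j k r → j ≤ i ℕ.+ r → T (inWin i (j ∸ i) k) → k ≤ i ℕ.+ r
  prefix⇒≤ i j k r j≤ k∈ =
    ≤-trans (inWin⇒≤ i (j ∸ i) k k∈) (+-monoʳ-≤ i (m≤n+o⇒m∸n≤o j i j≤))

  window-shift : ∀ i r {j k k′ m} → j ≤ i ℕ.+ r → k ≤ k′ → i ℕ.+ (k′ ℕ.+ r) ≤ m → j ℕ.+ k ≤ m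
  window-shift i r {j} {k} {k′} {m} j≤ k≤ bound = begin
    j ℕ.+ k           ≤⟨ +-mono-≤ j≤ k≤ ⟩
    i ℕ.+ r ℕ.+ k′    ≡⟨ +-assoc i r k′ ⟩
    i ℕ.+ (r ℕ.+ k′)  ≡⟨ cong (i ℕ.+_) (+-comm r k′) ⟩
    i ℕ.+ (k′ ℕ.+ r)  ≤⟨ bound ⟩
    m                 ∎
    where open ≤-Reasoning

  module _ (h : ℚ) (hp : h > 0ℚ) {A : Set} {n : ℕ} {E E′ : Env A n} {m : ℕ}
           (agree : AgreeUpTo E E′ m) where

    private
      K : Formula A → ℕ
      K = lookaheadFrames h hp
      ⊔ˡ : ∀ i a b → i ℕ.+ (a ⊔ b) ≤ m → i ℕ.+ a ≤ m
      ⊔ˡ i a b = ≤-trans (+-monoʳ-≤ i (m≤m⊔n a b))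
      ⊔ʳ : ∀ i a b → i ℕ.+ (a ⊔ b) ≤ m → i ℕ.+ b ≤ m
      ⊔ʳ i a b = ≤-trans (+-monoʳ-≤ i (m≤n⊔m a b))

    ⟦⟧-local : ∀ (φ : Formula A) (i : Fin n) → toℕ i ℕ.+ K φ ≤ m → ⟦ φ ⟧ h hp E i ≡ ⟦ φ ⟧ h hp E′ i
    ⟦⟧-local (atom a) i bound = agree a i (≤-trans (m≤m+n (toℕ i) 0) bound)
    ⟦⟧-local (¬′ φ)   i bound = cong not (⟦⟧-local φ i bound)
    ⟦⟧-local (φ ∧′ ψ) i bound = cong₂ _∧_
      (⟦⟧-local φ i (⊔ˡ (toℕ i) (K φ) (K ψ) bound)) (⟦⟧-local ψ i (⊔ʳ (toℕ i) (K φ) (K ψ) bound))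
    ⟦⟧-local (φ ∨′ ψ) i bound = cong₂ _∨_
      (⟦⟧-local φ i (⊔ˡ (toℕ i) (K φ) (K ψ) bound)) (⟦⟧-local ψ i (⊔ʳ (toℕ i) (K φ) (K ψ) bound))
    ⟦⟧-local (φ ⇒′ ψ) i bound = cong₂ (λ x y → not x ∨ y)
      (⟦⟧-local φ i (⊔ˡ (toℕ i) (K φ) (K ψ) bound)) (⟦⟧-local ψ i (⊔ʳ (toℕ i) (K φ) (K ψ) bound))
    ⟦⟧-local (N′ ε _ φ) i bound = anyF-cong λ j →
      guarded-∧-cong (dist (toℕ i) (toℕ j) ≤ᵇ r h hp ε) λ j∈ →
        ⟦⟧-local φ j (window-shift (toℕ i) (r h hp ε)
          (dist≤⇒≤ (toℕ i) (toℕ j) (r h hp ε) j∈) ≤-refl bound)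
    ⟦⟧-local (F′ ε _ φ) i bound = anyF-cong λ j →
      guarded-∧-cong (inWin (toℕ i) (r h hp ε) (toℕ j)) λ j∈ →
        ⟦⟧-local φ j (window-shift (toℕ i) (r h hp ε)
          (inWin⇒≤ (toℕ i) (r h hp ε) (toℕ j) j∈) ≤-refl bound)
    ⟦⟧-local (G′ ε _ φ) i bound = allF-cong λ j →
      guarded-⇒-cong (inWin (toℕ i) (r h hp ε) (toℕ j)) λ j∈ →
        ⟦⟧-local φ j (window-shift (toℕ i) (r h hp ε)
          (inWin⇒≤ (toℕ i) (r h hp ε) (toℕ j) j∈) ≤-refl bound)
    ⟦⟧-local (U′ ε _ φ ψ) i bound = anyF-cong λ j →
      guarded-∧-cong (inWin (toℕ i) (r h hp ε) (toℕ j)) λ j∈ →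
        let j≤ = inWin⇒≤ (toℕ i) (r h hp ε) (toℕ j) j∈ in
        cong₂ _∧_
          (⟦⟧-local ψ j (window-shift (toℕ i) (r h hp ε) j≤ (m≤n⊔m (K φ) (K ψ)) bound))
          (allF-cong λ k → guarded-⇒-cong (inWin (toℕ i) (toℕ j ∸ toℕ i) (toℕ k)) λ k∈ →
            ⟦⟧-local φ k (window-shift (toℕ i) (r h hp ε)
              (prefix⇒≤ (toℕ i) (toℕ j) (toℕ k) (r h hp ε) j≤ k∈) (m≤m⊔n (K φ) (K ψ)) bound))

open FrameLocality

open import Data.Rational as ℚ
  using (ℚ; 0ℚ; _>_; _≤_; _+_; _÷_; >-nonZero; mkℚ; _*_; _⊔_; NonZero; NonNegative; *≤*)
import Data.Rational.Properties as ℚ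
open import Data.Rational.Unnormalised as ℚᵘ using (mkℚᵘ; *≡*)
import Data.Rational.Unnormalised.Properties as ℚᵘ
import Data.Nat as ℕ
import Data.Nat.Properties as ℕ
open import Data.Nat.Coprimality using (1-coprimeTo)
import Data.Nat.Coprimality as Coprime
open import Data.Integer as ℤ using (+≤+)
import Data.Integer.Properties as ℤ
open import Data.Sum using (inj₁; inj₂)
open import Relation.Binary.PropositionalEquality
  using (sym; trans; cong; cong₂; subst; subst₂; module ≡-Reasoning)

ℕ→ℚ≡mkℚ : ∀ k → ℕ→ℚ k ≡ mkℚ (ℤ.+ k) 0 (Coprime.sym (1-coprimeTo k))
ℕ→ℚ≡mkℚ k = ℚ.normalize-coprime (Coprime.sym (1-coprimeTo k))

ℕ→ℚ-mono-≤ : ∀ {a b} → a ℕ.≤ b → ℕ→ℚ a ≤ ℕ→ℚ b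
ℕ→ℚ-mono-≤ {a} {b} a≤b = subst₂ _≤_ (sym (ℕ→ℚ≡mkℚ a)) (sym (ℕ→ℚ≡mkℚ b))
  (*≤* (subst₂ ℤ._≤_ (sym (ℤ.*-identityʳ (ℤ.+ a))) (sym (ℤ.*-identityʳ (ℤ.+ b))) (+≤+ a≤b)))

ℕ→ℚ-homo-+ : ∀ a b → ℕ→ℚ (a ℕ.+ b) ≡ ℕ→ℚ a + ℕ→ℚ b
ℕ→ℚ-homo-+ a b = ℚ.toℚᵘ-injective (begin
  ℚ.toℚᵘ (ℕ→ℚ (a ℕ.+ b))              ≡⟨ cong ℚ.toℚᵘ (ℕ→ℚ≡mkℚ (a ℕ.+ b)) ⟩
  mkℚᵘ (ℤ.+ (a ℕ.+ b)) 0               ≈⟨ *≡* integral ⟩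
  mkℚᵘ (ℤ.+ a) 0 ℚᵘ.+ mkℚᵘ (ℤ.+ b) 0   ≡⟨ cong₂ ℚᵘ._+_ (cong ℚ.toℚᵘ (sym (ℕ→ℚ≡mkℚ a)))
                                                        (cong ℚ.toℚᵘ (sym (ℕ→ℚ≡mkℚ b))) ⟩
  ℚ.toℚᵘ (ℕ→ℚ a) ℚᵘ.+ ℚ.toℚᵘ (ℕ→ℚ b)  ≈⟨ ℚᵘ.≃-sym (ℚ.toℚᵘ-homo-+ (ℕ→ℚ a) (ℕ→ℚ b)) ⟩
  ℚ.toℚᵘ (ℕ→ℚ a + ℕ→ℚ b)              ∎)
  where
  open ℚᵘ.≃-Reasoning
  integral : (ℤ.+ (a ℕ.+ b)) ℤ.* ℤ.1ℤ ≡ ((ℤ.+ a) ℤ.* ℤ.1ℤ ℤ.+ (ℤ.+ b) ℤ.* ℤ.1ℤ) ℤ.* ℤ.1ℤ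
  integral = trans (ℤ.*-identityʳ _)
    (trans (cong₂ ℤ._+_ (sym (ℤ.*-identityʳ (ℤ.+ a))) (sym (ℤ.*-identityʳ (ℤ.+ b))))
           (sym (ℤ.*-identityʳ _)))

ℕ→ℚ-distrib-⊔ : ∀ a b → ℕ→ℚ (a ℕ.⊔ b) ≡ ℕ→ℚ a ⊔ ℕ→ℚ b
ℕ→ℚ-distrib-⊔ a b with ℕ.≤-total a b
... | inj₁ a≤b = trans (cong ℕ→ℚ (ℕ.m≤n⇒m⊔n≡n a≤b)) (sym (ℚ.p≤q⇒p⊔q≡q (ℕ→ℚ-mono-≤ a≤b)))
... | inj₂ b≤a = trans (cong ℕ→ℚ (ℕ.m≥n⇒m⊔n≡m b≤a)) (sym (ℚ.p≥q⇒p⊔q≡p (ℕ→ℚ-mono-≤ b≤a)))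

*-÷-cancelʳ : ∀ p q .{{_ : NonZero q}} → (p * q) ÷ q ≡ p
*-÷-cancelʳ p q = begin
  p * q * ℚ.1/ q     ≡⟨ ℚ.*-assoc p q (ℚ.1/ q) ⟩
  p * (q * ℚ.1/ q)   ≡⟨ cong (p *_) (ℚ.*-inverseʳ q) ⟩
  p * ℚ.1ℚ           ≡⟨ ℚ.*-identityʳ p ⟩
  p                  ∎
  where open ≡-Reasoning

module _ (h : ℚ) (hp : h > 0ℚ) where

  private
    instance
      h≢0 : NonZero h
      h≢0 = >-nonZero hp
      h≥0 : NonNegative h
      h≥0 = ℚ.nonNegative (ℚ.<⇒≤ hp)

    K : ∀ {A} → Formula A → ℕ
    K = lookaheadFrames h hp

    ⊔-scaled : ∀ a b → ℕ→ℚ a * h ⊔ ℕ→ℚ b * h ≡ ℕ→ℚ (a ℕ.⊔ b) * h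
    ⊔-scaled a b = trans (sym (ℚ.*-distribʳ-⊔-nonNeg h (ℕ→ℚ a) (ℕ→ℚ b)))
                         (cong (_* h) (sym (ℕ→ℚ-distrib-⊔ a b)))

    +-scaled : ∀ a b → ℕ→ℚ a * h + ℕ→ℚ b * h ≡ ℕ→ℚ (a ℕ.+ b) * h
    +-scaled a b = trans (sym (ℚ.*-distribʳ-+ h (ℕ→ℚ a) (ℕ→ℚ b)))
                         (cong (_* h) (sym (ℕ→ℚ-homo-+ a b)))

  L≡lookaheadFrames*h : ∀ {A} (φ : Formula A) → L h hp φ ≡ ℕ→ℚ (K φ) * h
  L≡lookaheadFrames*h (atom a) = sym (ℚ.*-zeroˡ h)
  L≡lookaheadFrames*h (¬′ φ) = L≡lookaheadFrames*h φ
  L≡lookaheadFrames*h (φ ∧′ ψ) =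
    trans (cong₂ _⊔_ (L≡lookaheadFrames*h φ) (L≡lookaheadFrames*h ψ)) (⊔-scaled (K φ) (K ψ))
  L≡lookaheadFrames*h (φ ∨′ ψ) =
    trans (cong₂ _⊔_ (L≡lookaheadFrames*h φ) (L≡lookaheadFrames*h ψ)) (⊔-scaled (K φ) (K ψ))
  L≡lookaheadFrames*h (φ ⇒′ ψ) =
    trans (cong₂ _⊔_ (L≡lookaheadFrames*h φ) (L≡lookaheadFrames*h ψ)) (⊔-scaled (K φ) (K ψ))
  L≡lookaheadFrames*h (N′ ε _ φ) = trans (cong (_+ _) (L≡lookaheadFrames*h φ)) (+-scaled (K φ) (r h hp ε))
  L≡lookaheadFrames*h (F′ ε _ φ) = trans (cong (_+ _) (L≡lookaheadFrames*h φ)) (+-scaled (K φ) (r h hp ε))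
  L≡lookaheadFrames*h (G′ ε _ φ) = trans (cong (_+ _) (L≡lookaheadFrames*h φ)) (+-scaled (K φ) (r h hp ε))
  L≡lookaheadFrames*h (U′ ε _ φ ψ) = trans
    (cong (_+ _) (trans (cong₂ _⊔_ (L≡lookaheadFrames*h φ) (L≡lookaheadFrames*h ψ)) (⊔-scaled (K φ) (K ψ))))
    (+-scaled (K φ ℕ.⊔ K ψ) (r h hp ε))

  L÷h≡lookaheadFrames : ∀ {A} (φ : Formula A) → L h hp φ ÷ h ≡ ℕ→ℚ (K φ)
  L÷h≡lookaheadFrames φ = trans (cong (_÷ h) (L≡lookaheadFrames*h φ)) (*-÷-cancelʳ (ℕ→ℚ (K φ)) h)

mainTheorem9 : {A : Set} (φ : Formula A) (h : ℚ) (hp : h > 0ℚ) (n : ℕ)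
    (i : Fin n) (E E′ : Env A n) →
    ((a : A) (j : Fin n) →
      ℕ→ℚ (toℕ j) ≤ ℕ→ℚ (toℕ i) + _÷_ (L h hp φ) h {{>-nonZero hp}} →
      E a j ≡ E′ a j) →
    ⟦ φ ⟧ h hp E i ≡ ⟦ φ ⟧ h hp E′ i
mainTheorem9 φ h hp n i E E′ agree = ⟦⟧-local h hp agreeInFrames φ i ℕ.≤-refl
  where
  K : ℕ
  K = lookaheadFrames h hp φ

  horizon : ℕ→ℚ (toℕ i ℕ.+ K) ≡ ℕ→ℚ (toℕ i) + _÷_ (L h hp φ) h {{>-nonZero hp}}
  horizon = trans (ℕ→ℚ-homo-+ (toℕ i) K)
                  (cong (ℕ→ℚ (toℕ i) +_) (sym (L÷h≡lookaheadFrames h hp φ)))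

  agreeInFrames : AgreeUpTo E E′ (toℕ i ℕ.+ K)
  agreeInFrames a j j≤ = agree a j (subst (ℕ→ℚ (toℕ j) ≤_) horizon (ℕ→ℚ-mono-≤ j≤))
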